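{- Let $\Lambda$ be an alphabet and $M\subseteq\Lambda^*\setminus\{\varepsilon\}$ a set of words such that (a) for all nonempty words $\underline{u},\underline{v}$, if $\underline{u}\underline{v}\in M$ and $\underline{v}\in M$ then $\underline{u}\in M$, and (b) $M$ is closed under taking nonempty initial segments (if $v_1\cdots v_n\in M$ then $v_1\cdots v_m\in M$ for all $1\le m\le n$). Consider the truncation game induced by $M$ on $\Lambda^*$. Let $\underline{u}=u_1\cdots u_m$ ($m\ge 1$) be a kernel position of this game. Then a word $\underline{v}=v_1\cdots v_n$ with $n\ge 1$ is a kernel position if and only if the concatenation $\underline{u}\underline{v}$ is a kernel position.
   Context: $\Lambda^*$ is the free monoid of finite words over $\Lambda$, with empty word $\varepsilon$. The truncation game induced by $M$ has as positions all words of $\Lambda^*$; a valid move replaces $v_1\cdots v_n$ by $v_1\cdots v_i$ ($0\le i<n$) whenever $v_{i+1}\cdots v_n\in M$. Players alternate; a player unable to move loses. The game is progressively finite; a kernel position is a position of Grundy number zero, i.e. positions are kernel positions exactly when every valid move from them leads to a non-kernel position (in particular positions with no valid move are kernel positions). -}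

module Defs where

open import Data.Nat using (ℕ; zero; suc; _<_; _≤_)
open import Data.List using (List; []; _∷_; _++_; length; take; drop)
open import Data.Empty using (⊥)
open import Data.Unit using (⊤)
open import Relation.Nullary using (¬_)
open import Relation.Binary.PropositionalEquality using (_≡_)

-- A valid move of the truncation game induced by M from w = v₁⋯vₙ goes to
-- take i w = v₁⋯vᵢ (0 ≤ i < n) provided drop i w = vᵢ₊₁⋯vₙ ∈ M.

-- Defined by recursion on a fuel
-- parameter bounding the word length (moves strictly shorten words).
KernelAt : {Λ : Set} → (List Λ → Set) → ℕ → List Λ → Set
KernelAt M zero    w = ⊤   -- only used for w = [], which has no moves
KernelAt M (suc k) w =
  (i : ℕ) → i < length w → M (drop i w) → ¬ KernelAt M k (take i w)

IsKernel : {Λ : Set} → (List Λ → Set) → List Λ → Set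
IsKernel M w = KernelAt M (length w) w

NoEmpty : {Λ : Set} → (List Λ → Set) → Set
NoEmpty M = ¬ M []

CondA : {Λ : Set} → (List Λ → Set) → Set
CondA {Λ} M = (u v : List Λ) → ¬ u ≡ [] → ¬ v ≡ [] → M (u ++ v) → M v → M u

CondB : {Λ : Set} → (List Λ → Set) → Set
CondB {Λ} M = (w : List Λ) (m : ℕ) → 1 ≤ m → m ≤ length w → M w → M (take m w)

module Submission where

-- In the truncation game a move from  u ++ v  cuts the word at some
-- position i.  If the cut falls inside u (i < |u|), then the removed suffix
-- drop i u ++ v lies in M, so by closure under initial segments (b) also
-- drop i u ∈ M; hence take i u is a position reachable from u in one move,
-- and since u is a kernel position, take i u — which equals take i (u ++ v) —
-- is not.  Such moves therefore never lead to a kernel position, whatever v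
-- is.  The remaining moves cut inside v, at i = |u| + j, and correspond
-- exactly to the moves  v ↦ take j v , landing in  u ++ take j v .  By
-- induction on |v|, u ++ take j v is a kernel position iff take j v is, so
-- u ++ v and v have the same kernel status.

open import Defs
open import Level using (0ℓ)
open import Data.List using (List; []; _∷_; _++_; length; take; drop)
open import Data.List.Properties using (length-take; length-++-≤ˡ)
open import Data.Product using (_×_; _,_)
open import Data.Nat using (ℕ; zero; suc; _+_; _≤_; _<_; z≤n; s≤s; s≤s⁻¹)
open import Data.Nat.Properties using (≤-trans; ≤-reflexive; ≤-refl; m⊓n≤m; n≮0; <-≤-trans)
open import Data.Unit using (tt)
open import Function using (_⇔_; mk⇔; Equivalence; _∘_)
open import Function.Properties.Equivalence using (⇔-setoid)
open import Relation.Nullary using (¬_; contradiction)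
import Relation.Binary.Reasoning.Setoid as SetoidReasoning
open import Relation.Binary.PropositionalEquality using (_≡_; refl; subst; sym; cong)

private
  variable
    Λ : Set

length-take< : (i : ℕ) (w : List Λ) {k : ℕ} →
               i < length w → length w ≤ suc k → length (take i w) ≤ k
length-take< i w i<w w≤1+k =
  ≤-trans (≤-trans (≤-reflexive (length-take i w)) (m⊓n≤m i (length w)))
          (s≤s⁻¹ (<-≤-trans i<w w≤1+k))

data CutOf (u v : List Λ) : ℕ → Set where
  inPrefix : {i : ℕ} → i < length u → CutOf u v i
  inSuffix : {j : ℕ} → j < length v → CutOf u v (length u + j)

cutOf : (u v : List Λ) (i : ℕ) → i < length (u ++ v) → CutOf u v i
cutOf []      v i       i<uv = inSuffix i<uv
cutOf (x ∷ u) v zero    _    = inPrefix (s≤s z≤n)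
cutOf (x ∷ u) v (suc i) i<uv with cutOf u v i (s≤s⁻¹ i<uv)
... | inPrefix i<u = inPrefix (s≤s i<u)
... | inSuffix j<v = inSuffix j<v

suffix-cut< : (u v : List Λ) {j : ℕ} → j < length v → length u + j < length (u ++ v)
suffix-cut< []      v j<v = j<v
suffix-cut< (x ∷ u) v j<v = s≤s (suffix-cut< u v j<v)

take-prefix : (u v : List Λ) {i : ℕ} → i < length u → take i (u ++ v) ≡ take i u
take-prefix (x ∷ u) v {zero}  _         = refl
take-prefix (x ∷ u) v {suc i} (s≤s i<u) = cong (x ∷_) (take-prefix u v i<u)

drop-prefix : (u v : List Λ) {i : ℕ} → i < length u → drop i (u ++ v) ≡ drop i u ++ v
drop-prefix (x ∷ u) v {zero}  _         = refl
drop-prefix (x ∷ u) v {suc i} (s≤s i<u) = drop-prefix u v i<u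

take-suffix : (u v : List Λ) (j : ℕ) → take (length u + j) (u ++ v) ≡ u ++ take j v
take-suffix []      v j = refl
take-suffix (x ∷ u) v j = cong (x ∷_) (take-suffix u v j)

drop-suffix : (u v : List Λ) (j : ℕ) → drop (length u + j) (u ++ v) ≡ drop j v
drop-suffix []      v j = refl
drop-suffix (x ∷ u) v j = drop-suffix u v j

take-length-++ : (u v : List Λ) → take (length u) (u ++ v) ≡ u
take-length-++ []      v = refl
take-length-++ (x ∷ u) v = cong (x ∷_) (take-length-++ u v)

length-drop>0 : (u : List Λ) {i : ℕ} → i < length u → 1 ≤ length (drop i u)
length-drop>0 (x ∷ u) {zero}  _         = s≤s z≤n
length-drop>0 (x ∷ u) {suc i} (s≤s i<u) = length-drop>0 u i<u

module Kernel (M : List Λ → Set) where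

  NoKernelMove : List Λ → Set
  NoKernelMove w = (i : ℕ) → i < length w → M (drop i w) → ¬ IsKernel M (take i w)

  kernelAt-fuel : (k k′ : ℕ) (w : List Λ) → length w ≤ k → length w ≤ k′ →
                  KernelAt M k w → KernelAt M k′ w
  kernelAt-fuel k       zero     w       _    _     _ = tt
  kernelAt-fuel zero    (suc k′) []      _    _     _ = λ _ ()
  kernelAt-fuel (suc k) (suc k′) w w≤1+k w≤1+k′ K i i<w m K′ =
    K i i<w m (kernelAt-fuel k′ k (take i w)
                 (length-take< i w i<w w≤1+k′) (length-take< i w i<w w≤1+k) K′)

  kernel-take⇔ : (x : Λ) (w : List Λ) (i : ℕ) → i < length (x ∷ w) →
                 IsKernel M (take i (x ∷ w)) ⇔ KernelAt M (length w) (take i (x ∷ w))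
  kernel-take⇔ x w i i<w = mk⇔
    (kernelAt-fuel _ _ _ ≤-refl (length-take< i (x ∷ w) i<w ≤-refl))
    (kernelAt-fuel _ _ _ (length-take< i (x ∷ w) i<w ≤-refl) ≤-refl)

  kernel⇔noKernelMove : (w : List Λ) → IsKernel M w ⇔ NoKernelMove w
  kernel⇔noKernelMove []      = mk⇔ (λ _ _ ()) (λ _ → tt)
  kernel⇔noKernelMove (x ∷ w) = mk⇔
    (λ K i i<w m K′ → K i i<w m (Equivalence.to   (kernel-take⇔ x w i i<w) K′))
    (λ N i i<w m K′ → N i i<w m (Equivalence.from (kernel-take⇔ x w i i<w) K′))

  NoSuffixKernelMove : List Λ → List Λ → Set
  NoSuffixKernelMove u v =
    (j : ℕ) → j < length v → M (drop j v) → ¬ IsKernel M (u ++ take j v)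

  module Concatenation (closedB : CondB M) {u : List Λ} (Ku : IsKernel M u) where

    -- A cut inside u never leads to a kernel position: it is also a move of u.
    prefix-cut-losing : (v : List Λ) {i : ℕ} → i < length u →
                        M (drop i (u ++ v)) → ¬ IsKernel M (take i (u ++ v))
    prefix-cut-losing v {i} i<u m K =
      Equivalence.to (kernel⇔noKernelMove u) Ku i i<u
        (subst M (take-length-++ (drop i u) v) drop-i-u∈M)
        (subst (IsKernel M) (take-prefix u v i<u) K)
      where
      drop-i-u∈M : M (take (length (drop i u)) (drop i u ++ v))
      drop-i-u∈M = closedB (drop i u ++ v) (length (drop i u))
                     (length-drop>0 u i<u) (length-++-≤ˡ (drop i u))
                     (subst M (drop-prefix u v i<u) m)

    noKernelMove-++ : (v : List Λ) → NoKernelMove (u ++ v) ⇔ NoSuffixKernelMove u v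
    noKernelMove-++ v = mk⇔
      (λ N j j<v m K → N (length u + j) (suffix-cut< u v j<v)
                         (subst M (sym (drop-suffix u v j)) m)
                         (subst (IsKernel M) (sym (take-suffix u v j)) K))
      fromSuffix
      where
      fromSuffix : NoSuffixKernelMove u v → NoKernelMove (u ++ v)
      fromSuffix S i i<uv with cutOf u v i i<uv
      ... | inPrefix i<u = prefix-cut-losing v i<u
      ... | inSuffix {j} j<v = λ m K →
        S j j<v (subst M (drop-suffix u v j) m) (subst (IsKernel M) (take-suffix u v j) K)

    kernel-++-step : (v : List Λ) →
                     ((j : ℕ) → j < length v → IsKernel M (take j v) ⇔ IsKernel M (u ++ take j v)) →
                     IsKernel M v ⇔ IsKernel M (u ++ v)
    kernel-++-step v IH = begin
      IsKernel M v            ≈⟨ kernel⇔noKernelMove v ⟩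
      NoKernelMove v          ≈⟨ mk⇔ (λ N j j<v m → N j j<v m ∘ Equivalence.from (IH j j<v))
                                     (λ S j j<v m → S j j<v m ∘ Equivalence.to (IH j j<v)) ⟩
      NoSuffixKernelMove u v  ≈⟨ noKernelMove-++ v ⟨
      NoKernelMove (u ++ v)   ≈⟨ kernel⇔noKernelMove (u ++ v) ⟨
      IsKernel M (u ++ v)     ∎
      where open SetoidReasoning (⇔-setoid 0ℓ)

    kernel-++-bounded : (n : ℕ) (v : List Λ) → length v ≤ n → IsKernel M v ⇔ IsKernel M (u ++ v)
    kernel-++-bounded zero    v v≤0   =
      kernel-++-step v (λ j j<v → contradiction (<-≤-trans j<v v≤0) n≮0)
    kernel-++-bounded (suc n) v v≤1+n =
      kernel-++-step v (λ j j<v → kernel-++-bounded n (take j v) (length-take< j v j<v v≤1+n))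

    kernel-++ : (v : List Λ) → IsKernel M v ⇔ IsKernel M (u ++ v)
    kernel-++ v = kernel-++-bounded (length v) v ≤-refl

proposition2p8 : {Λ : Set} (M : List Λ → Set) → NoEmpty M → CondA M → CondB M →
    (u : List Λ) → ¬ u ≡ [] → IsKernel M u →
    (v : List Λ) → ¬ v ≡ [] →
    (IsKernel M v → IsKernel M (u ++ v)) × (IsKernel M (u ++ v) → IsKernel M v)
proposition2p8 M _ _ closedB u _ Ku v _ = Equivalence.to kernel-++-v , Equivalence.from kernel-++-v
  where
  open Kernel M
  kernel-++-v : IsKernel M v ⇔ IsKernel M (u ++ v)
  kernel-++-v = Concatenation.kernel-++ closedB Ku v
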